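{- Let $n\geq 2$. The number of rooted trees on $[n]$ whose root has a label larger than the labels of all its children, and in which every non-root vertex has a label smaller than the labels of all its children, equals $n!/2$.
   Context: A rooted tree on $[n]$ is an unordered (non-planar) rooted tree whose $n$ vertices are labeled bijectively by $[n]$. (In the paper's terminology: the tree has a proper descent at the root and no other descents, where a vertex is a descent if it is greater than at least one of its children and a proper descent if it is greater than all of its children.) -}

module Defs where

open import Data.Nat using (ℕ; zero; suc)
open import Data.Fin using (Fin; _<_)
open import Data.Maybe using (Maybe; just; nothing; _>>=_)
open import Data.Vec using (Vec; lookup)
open import Data.List using (List; length)
open import Data.List.Membership.Propositional using (_∈_)
open import Data.List.Relation.Unary.Unique.Propositional using (Unique)
open import Data.Product using (Σ; ∃; _×_)
open import Function.Bundles using (_⇔_)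
open import Relation.Binary.PropositionalEquality using (_≡_; _≢_)

-- A (non-planar) rooted tree on the vertex set Fin n (standing for [n]) is
-- encoded by its parent vector: entry v is  just p  if p is the parent of v,
-- and  nothing  if v is the root.  This encoding is a bijection between
-- rooted labelled trees on [n] and the parent vectors satisfying IsRootedTree.
ParentVec : ℕ → Set
ParentVec n = Vec (Maybe (Fin n)) n

ancestor : ∀ {n} → ParentVec n → ℕ → Fin n → Maybe (Fin n)
ancestor par zero    v = just v
ancestor par (suc k) v = ancestor par k v >>= lookup par

-- r is the root of the tree encoded by par: r has no parent, and every vertex
-- reaches r by following parents (so there are no cycles and no other roots).
IsRootOf : ∀ {n} → ParentVec n → Fin n → Set
IsRootOf par r = (lookup par r ≡ nothing) × (∀ v → ∃ λ k → ancestor par k v ≡ just r)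

IsChild : ∀ {n} → ParentVec n → Fin n → Fin n → Set
IsChild par w v = lookup par w ≡ just v

IsRootDescentTree : ∀ {n} → ParentVec n → Set
IsRootDescentTree {n} par =
  Σ (Fin n) λ r → IsRootOf par r
    × (∀ w → IsChild par w r → w < r)
    × (∀ v → v ≢ r → ∀ w → IsChild par w v → v < w)

HasCount : {A : Set} → (A → Set) → ℕ → Set
HasCount {A} P k = Σ (List A) λ xs → Unique xs × (∀ x → (x ∈ xs) ⇔ P x) × (length xs ≡ k)

-- Whether a parent vector is a root-descent tree with root r can be checked entry by entry:
-- the root has no parent, a vertex v < r has as parent either r or some p < v, and a vertex
-- v > r has as parent some p < v other than r.  Parents other than the root are then smaller,
-- so every vertex climbs down to r and the vector really is a tree.  The trees with root r are
-- therefore counted by the product over v of the number of admissible parents, which is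
-- r! · r(r+1)⋯(n-2) = r · (n-2)! (labels 0, …, n-1), and summing over r gives n!/2.
module Submission where

open import Defs
open import Data.Empty using (⊥-elim)
open import Data.Fin using (Fin; zero; suc; toℕ; _<_; _≟_)
open import Data.Fin.Induction using (<-wellFounded)
import Data.Fin.Properties as Finₚ
open import Data.List
  using (List; []; _∷_; [_]; _++_; length; map; filter; cartesianProduct; tabulate; applyUpTo; upTo)
open import Data.List.Membership.Propositional using (_∈_)
open import Data.List.Membership.Propositional.Properties
  using (∈-map⁺; ∈-map⁻; ++-∈⇔; ∈-cartesianProduct⁺; ∈-cartesianProduct⁻; ∈-filter⁺; ∈-filter⁻)
open import Data.List.Membership.Propositional.Properties.WithK using (unique∧set⇒bag)
open import Data.List.Properties using (length-++; length-map; tabulate-cong; applyUpTo-∷ʳ; upTo-∷ʳ; map-upTo)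
open import Data.List.Relation.Binary.BagAndSetEquality using (∼bag⇒↭)
open import Data.List.Relation.Binary.Permutation.Propositional.Properties using (↭-length)
open import Data.List.Relation.Unary.All using ([])
open import Data.List.Relation.Unary.AllPairs using ([]; _∷_)
open import Data.List.Relation.Unary.Any using (here)
import Data.List.Relation.Unary.Unique.Propositional.Properties as Unique
open import Data.Maybe using (Maybe; just; nothing; _>>=_)
open import Data.Maybe.Properties using (just-injective)
open import Data.Nat as ℕ using (ℕ; zero; suc; _+_; _*_; _∸_; _≤_; _/_; _!; s≤s; z≤n)
import Data.Nat.DivMod as DivMod
open import Data.Nat.ListAction using (sum; product)
open import Data.Nat.ListAction.Properties using (sum-++; product-++)
open import Data.Nat.Properties as ℕₚ using (<-cmp)
open import Data.Product using (∃; _×_; _,_; proj₁; proj₂; uncurry)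
open import Data.Product.Properties using (×-≡,≡→≡)
open import Data.Sum as Sum using (_⊎_; inj₁; inj₂)
open import Data.Vec using (Vec; []; _∷_; lookup)
open import Data.Vec.Properties using (∷-injective)
open import Function using (_∘_; Injective)
open import Function.Bundles using (_⇔_; mk⇔; Equivalence)
import Function.Properties.Equivalence as ⇔
open import Induction.WellFounded using (Acc; acc)
open import Relation.Binary.Definitions using (DecidableEquality; tri<; tri≈; tri>)
open import Relation.Binary.PropositionalEquality hiding ([_])
open import Relation.Nullary using (¬_; ¬?; yes; no)

open Equivalence using (to; from)

private variable
  A B : Set
  a b k n : ℕ

length-cartesianProduct : (xs : List A) (ys : List B) →
                          length (cartesianProduct xs ys) ≡ length xs * length ys
length-cartesianProduct []       ys = refl
length-cartesianProduct (x ∷ xs) ys = begin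
  length (map (x ,_) ys ++ cartesianProduct xs ys)
    ≡⟨ length-++ (map (x ,_) ys) ⟩
  length (map (x ,_) ys) + length (cartesianProduct xs ys)
    ≡⟨ cong₂ _+_ (length-map (x ,_) ys) (length-cartesianProduct xs ys) ⟩
  length ys + length xs * length ys
    ∎
  where open ≡-Reasoning

tabulate-toℕ : (f : ℕ → A) → tabulate {n = n} (f ∘ toℕ) ≡ applyUpTo f n
tabulate-toℕ {n = zero}  f = refl
tabulate-toℕ {n = suc n} f = cong (f 0 ∷_) (tabulate-toℕ (f ∘ suc))

sum-map-*ʳ : ∀ c (xs : List ℕ) → sum (map (_* c) xs) ≡ sum xs * c
sum-map-*ʳ c []       = refl
sum-map-*ʳ c (x ∷ xs) = trans (cong (x * c +_) (sum-map-*ʳ c xs)) (sym (ℕₚ.*-distribʳ-+ c x (sum xs)))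

product-applyUpTo-suc : ∀ (f : ℕ → ℕ) n → product (applyUpTo f (suc n)) ≡ product (applyUpTo f n) * f n
product-applyUpTo-suc f n = begin
  product (applyUpTo f (suc n))           ≡⟨ cong product (applyUpTo-∷ʳ f n) ⟨
  product (applyUpTo f n ++ [ f n ])      ≡⟨ product-++ (applyUpTo f n) [ f n ] ⟩
  product (applyUpTo f n) * (f n * 1)     ≡⟨ cong (product (applyUpTo f n) *_) (ℕₚ.*-identityʳ (f n)) ⟩
  product (applyUpTo f n) * f n           ∎
  where open ≡-Reasoning

sum-upTo-suc : ∀ n → sum (upTo (suc n)) ≡ sum (upTo n) + n
sum-upTo-suc n = begin
  sum (upTo (suc n))        ≡⟨ cong sum (upTo-∷ʳ n) ⟨
  sum (upTo n ++ [ n ])     ≡⟨ sum-++ (upTo n) [ n ] ⟩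
  sum (upTo n) + (n + 0)    ≡⟨ cong (sum (upTo n) +_) (ℕₚ.+-identityʳ n) ⟩
  sum (upTo n) + n          ∎
  where open ≡-Reasoning

sum-upTo-*2 : ∀ n → sum (upTo (suc n)) * 2 ≡ suc n * n
sum-upTo-*2 zero    = refl
sum-upTo-*2 (suc n) = begin
  sum (upTo (suc (suc n))) * 2          ≡⟨ cong (_* 2) (sum-upTo-suc (suc n)) ⟩
  (sum (upTo (suc n)) + suc n) * 2      ≡⟨ ℕₚ.*-distribʳ-+ 2 (sum (upTo (suc n))) (suc n) ⟩
  sum (upTo (suc n)) * 2 + suc n * 2    ≡⟨ cong (_+ suc n * 2) (sum-upTo-*2 n) ⟩
  suc n * n + suc n * 2                 ≡⟨ ℕₚ.*-distribˡ-+ (suc n) n 2 ⟨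
  suc n * (n + 2)                       ≡⟨ ℕₚ.*-comm (suc n) (n + 2) ⟩
  (n + 2) * suc n                       ≡⟨ cong (_* suc n) (ℕₚ.+-comm n 2) ⟩
  suc (suc n) * suc n                   ∎
  where open ≡-Reasoning

HasCount-resp : {P Q : A → Set} → (∀ x → P x ⇔ Q x) → HasCount P k → HasCount Q k
HasCount-resp P⇔Q (xs , uniq , mem , len) = xs , uniq , (λ x → ⇔.trans (mem x) (P⇔Q x)) , len

HasCount-unique : {P : A → Set} → HasCount P a → HasCount P b → a ≡ b
HasCount-unique (xs , uxs , mxs , refl) (ys , uys , mys , refl) =
  ↭-length (∼bag⇒↭ (unique∧set⇒bag uxs uys λ {x} → ⇔.trans (mxs x) (⇔.sym (mys x))))

HasCount-≡ : (a : A) → HasCount (_≡ a) 1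
HasCount-≡ a = [ a ] , [] ∷ [] , (λ x → mk⇔ (λ { (here x≡a) → x≡a }) (λ { refl → here refl })) , refl

HasCount-⊎ : {P Q : A → Set} → (∀ {x} → P x → ¬ Q x) →
             HasCount P a → HasCount Q b → HasCount (λ x → P x ⊎ Q x) (a + b)
HasCount-⊎ disjoint (xs , uxs , mxs , refl) (ys , uys , mys , refl) =
  xs ++ ys ,
  Unique.++⁺ uxs uys (λ (x∈xs , x∈ys) → disjoint (to (mxs _) x∈xs) (to (mys _) x∈ys)) ,
  (λ x → ⇔.trans ++-∈⇔
           (mk⇔ (Sum.map (to (mxs x)) (to (mys x))) (Sum.map (from (mxs x)) (from (mys x))))) ,
  length-++ xs

HasCount-image : {P : A → Set} (f : A → B) → Injective _≡_ _≡_ f →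
                 HasCount P k → HasCount (λ y → ∃ λ x → f x ≡ y × P x) k
HasCount-image {P = P} f f-inj (xs , uxs , mxs , refl) =
  map f xs , Unique.map⁺ f-inj uxs , (λ y → mk⇔ image⁺ image⁻) , length-map f xs
  where
  image⁺ : ∀ {y} → y ∈ map f xs → ∃ λ x → f x ≡ y × P x
  image⁺ y∈ with x , x∈xs , refl ← ∈-map⁻ f y∈ = x , refl , to (mxs x) x∈xs
  image⁻ : ∀ {y} → (∃ λ x → f x ≡ y × P x) → y ∈ map f xs
  image⁻ (x , refl , px) = ∈-map⁺ f (from (mxs x) px)

HasCount-× : {P : A → Set} {Q : B → Set} →
             HasCount P a → HasCount Q b → HasCount (λ (x , y) → P x × Q y) (a * b)
HasCount-× (xs , uxs , mxs , refl) (ys , uys , mys , refl) =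
  cartesianProduct xs ys ,
  Unique.cartesianProduct⁺ uxs uys ,
  (λ (x , y) → mk⇔ (λ xy∈ → let x∈xs , y∈ys = ∈-cartesianProduct⁻ xs ys xy∈
                             in to (mxs x) x∈xs , to (mys y) y∈ys)
                   (λ (px , qy) → ∈-cartesianProduct⁺ (from (mxs x) px) (from (mys y) qy))) ,
  length-cartesianProduct xs ys

HasCount-∃Fin : {Q : Fin n → A → Set} {k : Fin n → ℕ} → (∀ {i j x} → Q i x → Q j x → i ≡ j) →
                (∀ i → HasCount (Q i) (k i)) → HasCount (λ x → ∃ λ i → Q i x) (sum (tabulate k))
HasCount-∃Fin {n = zero}  _        _     = [] , [] , (λ x → mk⇔ (λ ()) (λ ())) , refl
HasCount-∃Fin {n = suc n} {Q = Q} disjoint count =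
  HasCount-resp (λ x → mk⇔ Sum.[ zero ,_ , (λ (i , q) → suc i , q) ] split)
    (HasCount-⊎ (λ q₀ (i , qᵢ) → Finₚ.0≢1+n (disjoint q₀ qᵢ))
      (count zero) (HasCount-∃Fin (λ qᵢ qⱼ → Finₚ.suc-injective (disjoint qᵢ qⱼ)) (count ∘ suc)))
  where
  split : ∀ {x} → (∃ λ i → Q i x) → Q zero x ⊎ ∃ λ i → Q (suc i) x
  split (zero  , q) = inj₁ q
  split (suc i , q) = inj₂ (i , q)

HasCount-∀Fin : {P : Fin n → A → Set} {k : Fin n → ℕ} → (∀ i → HasCount (P i) (k i)) →
                HasCount (λ (xs : Vec A n) → ∀ i → P i (lookup xs i)) (product (tabulate k))
HasCount-∀Fin {n = zero}  _     = [ [] ] , [] ∷ [] , (λ { [] → mk⇔ (λ _ ()) (λ _ → here refl) }) , refl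
HasCount-∀Fin {n = suc n} {P = P} count =
  HasCount-resp (λ xs → mk⇔ (uncons⁻ {xs}) (uncons⁺ xs))
    (HasCount-image (uncurry _∷_) (×-≡,≡→≡ ∘ ∷-injective)
      (HasCount-× (count zero) (HasCount-∀Fin (count ∘ suc))))
  where
  Tail : Vec _ n → Set
  Tail ys = ∀ i → P (suc i) (lookup ys i)
  uncons⁻ : ∀ {xs} → (∃ λ (y , ys) → y ∷ ys ≡ xs × P zero y × Tail ys) → ∀ i → P i (lookup xs i)
  uncons⁻ (_ , refl , py , pys) zero    = py
  uncons⁻ (_ , refl , py , pys) (suc i) = pys i
  uncons⁺ : ∀ xs → (∀ i → P i (lookup xs i)) → ∃ λ (y , ys) → y ∷ ys ≡ xs × P zero y × Tail ys
  uncons⁺ (y ∷ ys) p = (y , ys) , refl , p zero , p ∘ suc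

HasCount-remove : {P : A → Set} {a : A} → DecidableEquality A →
                  HasCount P (suc k) → P a → HasCount (λ x → P x × x ≢ a) k
HasCount-remove {P = P} {a} _≟ᴬ_ count@(xs , uxs , mxs , _) pa =
  subst (HasCount _) (ℕₚ.suc-injective (HasCount-unique withA count)) withoutA
  where
  rest : List _
  rest = filter (λ x → ¬? (x ≟ᴬ a)) xs
  withoutA : HasCount (λ x → P x × x ≢ a) (length rest)
  withoutA =
    rest , Unique.filter⁺ _ uxs ,
    (λ x → mk⇔ (λ x∈ → let x∈xs , x≢a = ∈-filter⁻ _ x∈ in to (mxs x) x∈xs , x≢a)
                (λ (px , x≢a) → ∈-filter⁺ _ (from (mxs x) px) x≢a)) ,
    refl
  split : ∀ x → P x → x ≡ a ⊎ P x × x ≢ a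
  split x px with x ≟ᴬ a
  ... | yes x≡a = inj₁ x≡a
  ... | no  x≢a = inj₂ (px , x≢a)
  withA : HasCount P (1 + length rest)
  withA = HasCount-resp (λ x → mk⇔ Sum.[ (λ { refl → pa }) , proj₁ ] (split x))
            (HasCount-⊎ (λ x≡a (_ , x≢a) → x≢a x≡a) (HasCount-≡ a) withoutA)

HasCount-< : (v : Fin n) → HasCount (_< v) (toℕ v)
HasCount-< zero    = [] , [] , (λ p → mk⇔ (λ ()) (λ ())) , refl
HasCount-< {n = suc n} (suc v) =
  HasCount-resp (λ p → mk⇔ <-suc⁺ (<-suc⁻ p))
    (HasCount-⊎ (λ { refl (_ , () , _) })
      (HasCount-≡ {A = Fin (suc n)} zero) (HasCount-image suc Finₚ.suc-injective (HasCount-< v)))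
  where
  <-suc⁺ : ∀ {p} → p ≡ zero ⊎ (∃ λ q → suc q ≡ p × q < v) → p < suc v
  <-suc⁺ (inj₁ refl)             = s≤s z≤n
  <-suc⁺ (inj₂ (_ , refl , q<v)) = s≤s q<v
  <-suc⁻ : ∀ p → p < suc v → p ≡ zero ⊎ (∃ λ q → suc q ≡ p × q < v)
  <-suc⁻ zero    _         = inj₁ refl
  <-suc⁻ (suc q) (s≤s q<v) = inj₂ (q , refl , q<v)

data AdmissibleParent (r v : Fin n) : Maybe (Fin n) → Set where
  root      : v ≡ r → AdmissibleParent r v nothing
  rootChild : v < r → AdmissibleParent r v (just r)
  child     : ∀ {p} → v ≢ r → p ≢ r → p < v → AdmissibleParent r v (just p)

AdmissibleParents : Fin n → ParentVec n → Set
AdmissibleParents r par = ∀ v → AdmissibleParent r v (lookup par v)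

module _ {r v : Fin n} where

  AdmissibleParent-nothing : AdmissibleParent r v nothing → v ≡ r
  AdmissibleParent-nothing (root v≡r) = v≡r

  AdmissibleParent-root : AdmissibleParent r v (just r) → v < r
  AdmissibleParent-root (rootChild v<r)  = v<r
  AdmissibleParent-root (child _ r≢r _) = ⊥-elim (r≢r refl)

  AdmissibleParent-child : ∀ {p} → p ≢ r → AdmissibleParent r v (just p) → p < v
  AdmissibleParent-child r≢r (rootChild _)  = ⊥-elim (r≢r refl)
  AdmissibleParent-child _   (child _ _ p<v) = p<v

AdmissibleParent-self : {r : Fin n} {m : Maybe (Fin n)} → AdmissibleParent r r m → m ≡ nothing
AdmissibleParent-self (root _)        = refl
AdmissibleParent-self (rootChild r<r) = ⊥-elim (Finₚ.<-irrefl refl r<r)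
AdmissibleParent-self (child r≢r _ _) = ⊥-elim (r≢r refl)

AdmissibleParents-functional : {r s : Fin n} {par : ParentVec n} →
                               AdmissibleParents r par → AdmissibleParents s par → r ≡ s
AdmissibleParents-functional {r = r} adm-r adm-s =
  AdmissibleParent-nothing (subst (AdmissibleParent _ r) (AdmissibleParent-self (adm-r r)) (adm-s r))

module _ (par : ParentVec n) where

  ancestor-suc : ∀ k v → ancestor par (suc k) v ≡ (lookup par v >>= ancestor par k)
  ancestor-suc zero    v with lookup par v
  ... | nothing = refl
  ... | just _  = refl
  ancestor-suc (suc k) v rewrite ancestor-suc k v with lookup par v
  ... | nothing = refl
  ... | just _  = refl

  ancestor-parentless : ∀ {v w} k → lookup par v ≡ nothing → ancestor par k v ≡ just w → v ≡ w
  ancestor-parentless zero    _       refl = refl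
  ancestor-parentless (suc k) no-parent anc
    with () ← trans (sym anc) (trans (ancestor-suc k _) (cong (_>>= ancestor par k) no-parent))

  module _ {r : Fin n} (adm : AdmissibleParents r par) where

    reaches-root : ∀ {v} → Acc _<_ v → ∃ λ k → ancestor par k v ≡ just r
    reaches-root {v} (acc rec) with lookup par v in parent-v | adm v
    ... | nothing | root refl    = 0 , refl
    ... | just _  | rootChild _  = 1 , trans (ancestor-suc 0 v) (cong (_>>= just) parent-v)
    ... | just p  | child _ _ p<v =
      let k , anc = reaches-root (rec p<v)
      in suc k , trans (ancestor-suc k v) (trans (cong (_>>= ancestor par k) parent-v) anc)

    admissible⇒rootDescentTree : IsRootDescentTree par
    admissible⇒rootDescentTree =
      r ,
      (AdmissibleParent-self (adm r) , λ v → reaches-root (<-wellFounded v)) ,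
      (λ w w→r → AdmissibleParent-root (subst (AdmissibleParent r w) w→r (adm w))) ,
      (λ v v≢r w w→v → AdmissibleParent-child v≢r (subst (AdmissibleParent r w) w→v (adm w)))

  rootDescentTree⇒admissible : (tree : IsRootDescentTree par) → AdmissibleParents (proj₁ tree) par
  rootDescentTree⇒admissible (r , (no-parent , reach) , root-children , children) v
    with lookup par v in parent-v | v ≟ r
  ... | nothing | yes v≡r = root v≡r
  ... | nothing | no  v≢r = ⊥-elim (v≢r (ancestor-parentless (proj₁ (reach v)) parent-v (proj₂ (reach v))))
  ... | just p  | yes refl with () ← trans (sym parent-v) no-parent
  ... | just p  | no v≢r with p ≟ r
  ...   | yes refl = rootChild (root-children v parent-v)
  ...   | no  p≢r  = child v≢r p≢r (children p p≢r v parent-v)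

  rootDescentTree⇔admissible : IsRootDescentTree par ⇔ ∃ λ r → AdmissibleParents r par
  rootDescentTree⇔admissible =
    mk⇔ (λ tree → proj₁ tree , rootDescentTree⇒admissible tree)
        (λ (_ , adm) → admissible⇒rootDescentTree adm)

parentCount : ℕ → ℕ → ℕ
parentCount r v with <-cmp v r
... | tri< _ _ _ = suc v
... | tri≈ _ _ _ = 1
... | tri> _ _ _ = v ∸ 1

module _ {r v : ℕ} where

  parentCount-< : v ℕ.< r → parentCount r v ≡ suc v
  parentCount-< v<r with <-cmp v r
  ... | tri< _   _ _ = refl
  ... | tri≈ v≮r _ _ = ⊥-elim (v≮r v<r)
  ... | tri> v≮r _ _ = ⊥-elim (v≮r v<r)

  parentCount-> : r ℕ.< v → parentCount r v ≡ v ∸ 1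
  parentCount-> r<v with <-cmp v r
  ... | tri< _ _ r≮v = ⊥-elim (r≮v r<v)
  ... | tri≈ _ _ r≮v = ⊥-elim (r≮v r<v)
  ... | tri> _ _ _   = refl

parentCount-≡ : ∀ r → parentCount r r ≡ 1
parentCount-≡ r with <-cmp r r
... | tri< r<r _ _ = ⊥-elim (ℕₚ.<-irrefl refl r<r)
... | tri≈ _   _ _ = refl
... | tri> _ _ r<r = ⊥-elim (ℕₚ.<-irrefl refl r<r)

HasCount-AdmissibleParent-below : {r v : Fin n} → v < r → HasCount (AdmissibleParent r v) (suc (toℕ v))
HasCount-AdmissibleParent-below {r = r} {v} v<r =
  HasCount-resp (λ m → mk⇔ toAdmissible fromAdmissible)
    (HasCount-image just just-injective
      (HasCount-⊎ (λ { refl p<v → Finₚ.<-asym v<r p<v }) (HasCount-≡ r) (HasCount-< v)))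
  where
  toAdmissible : ∀ {m} → (∃ λ p → just p ≡ m × (p ≡ r ⊎ p < v)) → AdmissibleParent r v m
  toAdmissible (_ , refl , inj₁ refl) = rootChild v<r
  toAdmissible (_ , refl , inj₂ p<v)  =
    child (λ { refl → Finₚ.<-irrefl refl v<r }) (λ { refl → Finₚ.<-asym v<r p<v }) p<v
  fromAdmissible : ∀ {m} → AdmissibleParent r v m → ∃ λ p → just p ≡ m × (p ≡ r ⊎ p < v)
  fromAdmissible (root refl)     = ⊥-elim (Finₚ.<-irrefl refl v<r)
  fromAdmissible (rootChild _)   = r , refl , inj₁ refl
  fromAdmissible (child _ _ p<v) = _ , refl , inj₂ p<v

HasCount-AdmissibleParent-above : {r v : Fin n} → r < v → HasCount (AdmissibleParent r v) (toℕ v ∸ 1)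
HasCount-AdmissibleParent-above {r = r} {suc w} r<v =
  HasCount-resp (λ m → mk⇔ toAdmissible fromAdmissible)
    (HasCount-image just just-injective (HasCount-remove _≟_ (HasCount-< (suc w)) r<v))
  where
  toAdmissible : ∀ {m} → (∃ λ p → just p ≡ m × p < suc w × p ≢ r) → AdmissibleParent r (suc w) m
  toAdmissible (_ , refl , p<v , p≢r) = child (λ { refl → Finₚ.<-irrefl refl r<v }) p≢r p<v
  fromAdmissible : ∀ {m} → AdmissibleParent r (suc w) m → ∃ λ p → just p ≡ m × p < suc w × p ≢ r
  fromAdmissible (root refl)       = ⊥-elim (Finₚ.<-irrefl refl r<v)
  fromAdmissible (rootChild v<r)   = ⊥-elim (Finₚ.<-asym r<v v<r)
  fromAdmissible (child _ p≢r p<v) = _ , refl , p<v , p≢r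

HasCount-AdmissibleParent-self : (r : Fin n) → HasCount (AdmissibleParent r r) 1
HasCount-AdmissibleParent-self r =
  HasCount-resp (λ m → mk⇔ (λ { refl → root refl }) AdmissibleParent-self) (HasCount-≡ nothing)

HasCount-AdmissibleParent : (r v : Fin n) → HasCount (AdmissibleParent r v) (parentCount (toℕ r) (toℕ v))
HasCount-AdmissibleParent r v with Finₚ.<-cmp v r
... | tri< v<r _ _  = subst (HasCount _) (sym (parentCount-< v<r)) (HasCount-AdmissibleParent-below v<r)
... | tri≈ _ refl _ = subst (HasCount _) (sym (parentCount-≡ (toℕ r))) (HasCount-AdmissibleParent-self r)
... | tri> _ _ r<v  = subst (HasCount _) (sym (parentCount-> r<v)) (HasCount-AdmissibleParent-above r<v)

rootedTreeCount : Fin n → ℕ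
rootedTreeCount {n} r = product (tabulate {n = n} (parentCount (toℕ r) ∘ toℕ))

HasCount-AdmissibleParents : (r : Fin n) → HasCount (AdmissibleParents r) (rootedTreeCount r)
HasCount-AdmissibleParents r = HasCount-∀Fin (HasCount-AdmissibleParent r)

∏parentCount-below : ∀ {r} n → n ≤ r → product (applyUpTo (parentCount r) n) ≡ n !
∏parentCount-below zero    _   = refl
∏parentCount-below {r} (suc n) n<r = begin
  product (applyUpTo (parentCount r) (suc n))         ≡⟨ product-applyUpTo-suc (parentCount r) n ⟩
  product (applyUpTo (parentCount r) n) * parentCount r n
    ≡⟨ cong₂ _*_ (∏parentCount-below n (ℕₚ.<⇒≤ n<r)) (parentCount-< n<r) ⟩
  n ! * suc n                                         ≡⟨ ℕₚ.*-comm (n !) (suc n) ⟩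
  suc n !                                             ∎
  where open ≡-Reasoning

∏parentCount-above : ∀ r k → product (applyUpTo (parentCount (suc r)) (suc (suc (k + r)))) ≡ suc r * (k + r) !
∏parentCount-above r zero = begin
  product (applyUpTo (parentCount (suc r)) (suc (suc r)))
    ≡⟨ product-applyUpTo-suc (parentCount (suc r)) (suc r) ⟩
  product (applyUpTo (parentCount (suc r)) (suc r)) * parentCount (suc r) (suc r)
    ≡⟨ cong₂ _*_ (∏parentCount-below (suc r) ℕₚ.≤-refl) (parentCount-≡ (suc r)) ⟩
  suc r ! * 1                                         ≡⟨ ℕₚ.*-identityʳ (suc r !) ⟩
  suc r * r !                                         ∎
  where open ≡-Reasoning
∏parentCount-above r (suc k) = begin
  product (applyUpTo f (suc (suc (suc (k + r)))))     ≡⟨ product-applyUpTo-suc f (suc (suc (k + r))) ⟩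
  product (applyUpTo f (suc (suc (k + r)))) * f (suc (suc (k + r)))
    ≡⟨ cong₂ _*_ (∏parentCount-above r k) (parentCount-> (s≤s (s≤s (ℕₚ.m≤n+m r k)))) ⟩
  suc r * (k + r) ! * suc (k + r)                     ≡⟨ ℕₚ.*-assoc (suc r) ((k + r) !) (suc (k + r)) ⟩
  suc r * ((k + r) ! * suc (k + r))                   ≡⟨ cong (suc r *_) (ℕₚ.*-comm ((k + r) !) (suc (k + r))) ⟩
  suc r * suc (k + r) !                               ∎
  where
  open ≡-Reasoning
  f = parentCount (suc r)

-- For r = 0 the factor at v = 1 vanishes: a root labelled 0 has no possible child.
∏parentCount : ∀ m {r} → r ℕ.< 2 + m → product (applyUpTo (parentCount r) (2 + m)) ≡ r * m !
∏parentCount m {zero}  _               = refl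
∏parentCount m {suc r} (s≤s (s≤s r≤m)) =
  subst (λ x → product (applyUpTo (parentCount (suc r)) (suc (suc x))) ≡ suc r * x !)
        (ℕₚ.m∸n+n≡m r≤m) (∏parentCount-above r (m ∸ r))

half-factorial : ∀ m → sum (upTo (2 + m)) * m ! ≡ (2 + m) ! / 2
half-factorial m = begin
  s * m !           ≡⟨ DivMod.m*n/n≡m (s * m !) 2 ⟨
  s * m ! * 2 / 2   ≡⟨ cong (_/ 2) doubled ⟩
  (2 + m) ! / 2     ∎
  where
  open ≡-Reasoning
  s = sum (upTo (2 + m))
  doubled : s * m ! * 2 ≡ (2 + m) !
  doubled = begin
    s * m ! * 2             ≡⟨ ℕₚ.*-assoc s (m !) 2 ⟩
    s * (m ! * 2)           ≡⟨ cong (s *_) (ℕₚ.*-comm (m !) 2) ⟩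
    s * (2 * m !)           ≡⟨ ℕₚ.*-assoc s 2 (m !) ⟨
    s * 2 * m !             ≡⟨ cong (_* m !) (sum-upTo-*2 (suc m)) ⟩
    (2 + m) * suc m * m !   ≡⟨ ℕₚ.*-assoc (2 + m) (suc m) (m !) ⟩
    (2 + m) !               ∎

sum-rootedTreeCount : ∀ m → sum (tabulate (rootedTreeCount {2 + m})) ≡ (2 + m) ! / 2
sum-rootedTreeCount m = begin
  sum (tabulate (rootedTreeCount {2 + m}))
    ≡⟨ cong sum (tabulate-cong λ r →
         trans (cong product (tabulate-toℕ {n = 2 + m} (parentCount (toℕ r))))
               (∏parentCount m (Finₚ.toℕ<n r))) ⟩
  sum (tabulate {n = 2 + m} ((_* m !) ∘ toℕ))  ≡⟨ cong sum (tabulate-toℕ {n = 2 + m} (_* m !)) ⟩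
  sum (applyUpTo (_* m !) (2 + m))             ≡⟨ cong sum (map-upTo (_* m !) (2 + m)) ⟨
  sum (map (_* m !) (upTo (2 + m)))            ≡⟨ sum-map-*ʳ (m !) (upTo (2 + m)) ⟩
  sum (upTo (2 + m)) * m !                     ≡⟨ half-factorial m ⟩
  (2 + m) ! / 2                                ∎
  where open ≡-Reasoning

HasCount-admissible : HasCount (λ par → ∃ λ r → AdmissibleParents {n} r par)
                               (sum (tabulate (rootedTreeCount {n})))
HasCount-admissible =
  HasCount-∃Fin (λ {_ _ par} → AdmissibleParents-functional {par = par}) HasCount-AdmissibleParents

lemma6p1 : ∀ (n : ℕ) → 2 ≤ n → HasCount (IsRootDescentTree {n}) ((n !) / 2)
lemma6p1 (suc (suc m)) (s≤s (s≤s z≤n)) =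
  HasCount-resp (λ par → ⇔.sym (rootDescentTree⇔admissible par))
    (subst (HasCount _) (sum-rootedTreeCount m) (HasCount-admissible {2 + m}))
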